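{- Let $n\ge 3$ be an even integer and let $\mathcal{F}$ be a 1-factorisation of $Circ(2n,\{1,2\})$. If some configuration $C_e$ is a 2-configuration, then the configurations adjacent to $C_e$ are 3-configurations.
   Context: For a positive integer $N$ and $D\subseteq\{1,\dots,\lfloor N/2\rfloor\}$, the circulant graph $Circ(N,D)$ has vertex set $\mathbb{Z}_N$, with $u,v$ adjacent iff $u-v\equiv \pm d \pmod N$ for some $d\in D$. A 1-factor is a 1-regular spanning subgraph; a 1-factorisation is a partition of the edge set into 1-factors; regard a 1-factorisation as an edge colouring in which each 1-factor is a colour class. In $Circ(2n,\{1,2\})$ (arithmetic mod $2n$), a 1-edge is an edge $\{v,v+1\}$ and a 2-edge is an edge $\{v,v+2\}$. The configuration of the 1-edge $e=\{v,v+1\}$ is $C_e=\{\{v-1,v+1\},\{v,v+1\},\{v,v+2\}\}$; it is a $k$-configuration if exactly $k$ distinct colours (1-factors) occur on its three edges. Configurations $C_e$ and $C_{e'}$ are adjacent if $e\neq e'$ share a vertex. -}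

module Defs where

open import Data.Nat using (ℕ; zero; suc; _≟_)
open import Data.Fin using (Fin; zero; suc; toℕ; fromℕ; inject₁; lower₁)
open import Data.List using (List; []; _∷_; length; map)
open import Data.List.Membership.Propositional using (_∈_)
open import Data.List.Relation.Unary.Unique.Propositional using (Unique)
open import Data.Product using (Σ; _×_)
open import Data.Sum using (_⊎_)
open import Relation.Nullary using (¬_; yes; no)
open import Relation.Binary.PropositionalEquality using (_≡_; _≢_)

-- Vertices of Circ(N, D) are the elements of ℤ_N, represented by Fin N.
-- v ↦ v + 1 (mod N)
inc : ∀ {N} → Fin N → Fin N
inc {suc m} i with m ≟ toℕ i
... | yes _ = zero
... | no ne = suc (lower₁ i ne)

dec : ∀ {N} → Fin N → Fin N
dec {suc m} zero    = fromℕ m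
dec {suc m} (suc i) = inject₁ i

-- Edges of Circ(N, {1,2}) (N ≥ 6): the 1-edge {v, v+1} and the 2-edge {v, v+2}
-- for each vertex v.  For N ≥ 6 this indexing is a bijection onto the edge set.
data Edge (N : ℕ) : Set where
  one : Fin N → Edge N
  two : Fin N → Edge N

Incident : ∀ {N} → Fin N → Edge N → Set
Incident w (one v) = w ≡ v ⊎ w ≡ inc v
Incident w (two v) = w ≡ v ⊎ w ≡ inc (inc v)

-- A 1-factorisation regarded as an edge colouring c : each colour class
-- {e' | c e' ≡ c e} is a 1-factor, i.e. every vertex w is incident with
-- exactly one edge of that colour.
IsOneFactorisation : ∀ {N} {C : Set} → (Edge N → C) → Set
IsOneFactorisation {N} {C} c =
  (e : Edge N) (w : Fin N) →
  Σ (Edge N) λ e' → (Incident w e' × c e' ≡ c e)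
    × ((e'' : Edge N) → Incident w e'' → c e'' ≡ c e → e'' ≡ e')

-- The configuration C_e of the 1-edge e = {v, v+1}:
-- the edges {v-1, v+1}, {v, v+1}, {v, v+2}.
configuration : ∀ {N} → Fin N → List (Edge N)
configuration v = two (dec v) ∷ one v ∷ two v ∷ []

NumDistinct : {C : Set} → ℕ → List C → Set
NumDistinct {C} k xs =
  Σ (List C) λ L → length L ≡ k × Unique L
    × (∀ x → x ∈ xs → x ∈ L) × (∀ x → x ∈ L → x ∈ xs)

KConfiguration : ∀ {N} {C : Set} → (Edge N → C) → ℕ → Fin N → Set
KConfiguration c k v = NumDistinct k (map c (configuration v))

AdjacentConfigurations : ∀ {N} → Fin N → Fin N → Set
AdjacentConfigurations {N} v v' =
  one v ≢ one v' × Σ (Fin N) λ w → Incident w (one v) × Incident w (one v')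

-- At a vertex the colours of the edges are pairwise distinct, so in C_{v,v+1} the 1-edge
-- differs in colour from both 2-edges {v-1,v+1} and {v,v+2}; hence C_{v,v+1} is a
-- 2-configuration exactly when these two 2-edges share a colour, and a 3-configuration
-- otherwise. If {v-1,v+1} and {v,v+2} share a colour, then {v+1,v+3} (which meets
-- {v-1,v+1}) and {v-2,v} (which meets {v,v+2}) cannot have that colour, so the outer
-- 2-edges of C_{v+1,v+2} and of C_{v-1,v} differ in colour.
module Submission where

open import Defs
open import Data.Nat using (ℕ; _≤_; _+_; suc; _≟_; s≤s)
open import Data.Nat.Divisibility using (_∣_)
open import Data.Nat.Properties using (<⇒≢; m<n⇒m<1+n; n<1+n)
open import Data.Fin using (Fin; zero; suc; toℕ; fromℕ; inject₁)
open import Data.Fin.Properties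
  using (toℕ-fromℕ; toℕ-inject₁; inject₁ℕ<; inject₁-lower₁; lower₁-inject₁′; toℕ-injective)
open import Data.List using ([]; _∷_)
open import Data.List.Relation.Unary.Any using (here; there)
open import Data.List.Membership.Propositional using (_∈_)
open import Data.List.Relation.Unary.AllPairs using ([]; _∷_)
open import Data.List.Relation.Unary.All using ([]; _∷_)
open import Data.Product using (_,_)
open import Data.Sum using (_⊎_; inj₁; inj₂)
open import Relation.Nullary using (¬_; yes; no; contradiction)
open import Relation.Binary.PropositionalEquality

dec-inc : ∀ {m} (i : Fin (suc m)) → dec (inc i) ≡ i
dec-inc {m} i with m ≟ toℕ i
... | yes m≡i = toℕ-injective (trans (toℕ-fromℕ m) m≡i)
... | no m≢i  = inject₁-lower₁ i m≢i

inc-dec : ∀ {m} (i : Fin (suc m)) → inc (dec i) ≡ i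
inc-dec {m} zero with m ≟ toℕ (fromℕ m)
... | yes _   = refl
... | no m≢m  = contradiction (sym (toℕ-fromℕ m)) m≢m
inc-dec {m} (suc i) with m ≟ toℕ (inject₁ i)
... | yes m≡i = contradiction (sym m≡i) (<⇒≢ (inject₁ℕ< i))
... | no m≢i  = cong suc (lower₁-inject₁′ i m≢i)

inc-injective : ∀ {m} {i j : Fin (suc m)} → inc i ≡ inc j → i ≡ j
inc-injective {i = i} {j} eq = trans (sym (dec-inc i)) (trans (cong dec eq) (dec-inc j))

dec∘dec≢id : ∀ {k} (i : Fin (suc (suc (suc k)))) → dec (dec i) ≢ i
dec∘dec≢id zero          ()
dec∘dec≢id (suc zero)    ()
dec∘dec≢id (suc (suc i)) eq = <⇒≢ (m<n⇒m<1+n (n<1+n (toℕ i))) (begin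
  toℕ i                       ≡⟨ sym (toℕ-inject₁ i) ⟩
  toℕ (inject₁ i)             ≡⟨ sym (toℕ-inject₁ (inject₁ i)) ⟩
  toℕ (inject₁ (inject₁ i))   ≡⟨ cong toℕ eq ⟩
  toℕ (suc (suc i))           ∎)
  where open ≡-Reasoning

adjacent⇒inc⊎dec : ∀ {m} {v v' : Fin (suc m)} →
  AdjacentConfigurations v v' → v' ≡ inc v ⊎ v' ≡ dec v
adjacent⇒inc⊎dec (one≢one , w , inj₁ w≡v , inj₁ w≡v') =
  contradiction (cong one (trans (sym w≡v) w≡v')) one≢one
adjacent⇒inc⊎dec {v = v} {v'} (_ , w , inj₁ w≡v , inj₂ w≡v'+1) =
  inj₂ (trans (sym (dec-inc v')) (cong dec (trans (sym w≡v'+1) w≡v)))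
adjacent⇒inc⊎dec (_ , w , inj₂ w≡v+1 , inj₁ w≡v') = inj₁ (trans (sym w≡v') w≡v+1)
adjacent⇒inc⊎dec (one≢one , w , inj₂ w≡v+1 , inj₂ w≡v'+1) =
  contradiction (cong one (inc-injective (trans (sym w≡v+1) w≡v'+1))) one≢one

module _ {C : Set} {x y z : C} where

  numDistinct2⇒¬¬first≡last : NumDistinct 2 (x ∷ y ∷ z ∷ []) → x ≢ y → y ≢ z → ¬ ¬ x ≡ z
  numDistinct2⇒¬¬first≡last ((a ∷ b ∷ []) , refl , _ , covers , _) x≢y y≢z x≢z
    with lookup₂ (covers x (here refl))
       | lookup₂ (covers y (there (here refl)))
       | lookup₂ (covers z (there (there (here refl))))
    where
    lookup₂ : ∀ {u} → u ∈ a ∷ b ∷ [] → u ≡ a ⊎ u ≡ b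
    lookup₂ (here u≡a)         = inj₁ u≡a
    lookup₂ (there (here u≡b)) = inj₂ u≡b
  ... | inj₁ x≡a | inj₁ y≡a | _        = x≢y (trans x≡a (sym y≡a))
  ... | inj₂ x≡b | inj₂ y≡b | _        = x≢y (trans x≡b (sym y≡b))
  ... | inj₁ x≡a | inj₂ _   | inj₁ z≡a = x≢z (trans x≡a (sym z≡a))
  ... | inj₂ x≡b | inj₁ _   | inj₂ z≡b = x≢z (trans x≡b (sym z≡b))
  ... | inj₁ _   | inj₂ y≡b | inj₂ z≡b = y≢z (trans y≡b (sym z≡b))
  ... | inj₂ _   | inj₁ y≡a | inj₁ z≡a = y≢z (trans y≡a (sym z≡a))

  pairwise-distinct⇒numDistinct3 : x ≢ y → y ≢ z → x ≢ z → NumDistinct 3 (x ∷ y ∷ z ∷ [])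
  pairwise-distinct⇒numDistinct3 x≢y y≢z x≢z =
    (x ∷ y ∷ z ∷ []) , refl , (x≢y ∷ x≢z ∷ []) ∷ (y≢z ∷ []) ∷ [] ∷ [] , (λ _ p → p) , (λ _ p → p)

module OneFactorisation {m} {C : Set} {c : Edge (suc m) → C} (isOF : IsOneFactorisation c) where

  colour-injective-at : ∀ w {e e'} → Incident w e → Incident w e' → c e ≡ c e' → e ≡ e'
  colour-injective-at w {e} {e'} w∈e w∈e' ce≡ce' with isOF e w
  ... | _ , _ , unique = trans (unique e w∈e refl) (sym (unique e' w∈e' (sym ce≡ce')))

  colour-one≢colour-two : ∀ v → c (one v) ≢ c (two v)
  colour-one≢colour-two v eq with colour-injective-at v (inj₁ refl) (inj₁ refl) eq
  ... | ()

  colour-two-dec≢colour-one : ∀ v → c (two (dec v)) ≢ c (one v)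
  colour-two-dec≢colour-one v eq
    with colour-injective-at (inc v) (inj₂ (cong inc (sym (inc-dec v)))) (inj₂ refl) eq
  ... | ()

  -- C has no decidable equality, so a 2-configuration only yields the double negation.
  2-configuration⇒¬¬outer-colours-equal : ∀ {v} →
    KConfiguration c 2 v → ¬ ¬ c (two (dec v)) ≡ c (two v)
  2-configuration⇒¬¬outer-colours-equal {v} two-colours =
    numDistinct2⇒¬¬first≡last two-colours (colour-two-dec≢colour-one v) (colour-one≢colour-two v)

  outer-colours-distinct⇒3-configuration : ∀ {v} →
    c (two (dec v)) ≢ c (two v) → KConfiguration c 3 v
  outer-colours-distinct⇒3-configuration {v} =
    pairwise-distinct⇒numDistinct3 (colour-two-dec≢colour-one v) (colour-one≢colour-two v)

module _ {k} {C : Set} {c : Edge (suc (suc (suc k))) → C} (isOF : IsOneFactorisation c) where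
  open OneFactorisation isOF

  two-injective : ∀ {a b : Fin (suc (suc (suc k)))} → two a ≡ two b → a ≡ b
  two-injective refl = refl

  outer-colours-equal⇒next-outer-colours-distinct : ∀ {v} →
    c (two (dec v)) ≡ c (two v) → c (two (dec (inc v))) ≢ c (two (inc v))
  outer-colours-equal⇒next-outer-colours-distinct {v} outer-equal next-equal
    rewrite dec-inc v =
    dec∘dec≢id (inc v) (trans (cong dec (dec-inc v)) (two-injective
      (colour-injective-at (inc v) (inj₂ (cong inc (sym (inc-dec v)))) (inj₁ refl)
        (trans outer-equal next-equal))))

  outer-colours-equal⇒previous-outer-colours-distinct : ∀ {v} →
    c (two (dec v)) ≡ c (two v) → c (two (dec (dec v))) ≢ c (two (dec v))
  outer-colours-equal⇒previous-outer-colours-distinct {v} outer-equal previous-equal =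
    dec∘dec≢id v (two-injective
      (colour-injective-at v (inj₂ (sym (trans (cong inc (inc-dec (dec v))) (inc-dec v))))
        (inj₁ refl) (trans previous-equal outer-equal)))

  2-configuration⇒next-3-configuration : ∀ {v} →
    KConfiguration c 2 v → KConfiguration c 3 (inc v)
  2-configuration⇒next-3-configuration {v} two-colours =
    outer-colours-distinct⇒3-configuration {inc v} λ next-equal →
      2-configuration⇒¬¬outer-colours-equal two-colours λ outer-equal →
        outer-colours-equal⇒next-outer-colours-distinct outer-equal next-equal

  2-configuration⇒previous-3-configuration : ∀ {v} →
    KConfiguration c 2 v → KConfiguration c 3 (dec v)
  2-configuration⇒previous-3-configuration {v} two-colours =
    outer-colours-distinct⇒3-configuration {dec v} λ previous-equal →
      2-configuration⇒¬¬outer-colours-equal two-colours λ outer-equal →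
        outer-colours-equal⇒previous-outer-colours-distinct outer-equal previous-equal

  adjacent-to-2-configuration⇒3-configuration : ∀ {v v'} →
    KConfiguration c 2 v → AdjacentConfigurations v v' → KConfiguration c 3 v'
  adjacent-to-2-configuration⇒3-configuration two-colours adjacent
    with adjacent⇒inc⊎dec adjacent
  ... | inj₁ v'≡v+1 = subst (KConfiguration c 3) (sym v'≡v+1)
    (2-configuration⇒next-3-configuration two-colours)
  ... | inj₂ v'≡v-1 = subst (KConfiguration c 3) (sym v'≡v-1)
    (2-configuration⇒previous-3-configuration two-colours)

mainTheorem15 : (n : ℕ) → 3 ≤ n → 2 ∣ n →
    {C : Set} (c : Edge (n + n) → C) → IsOneFactorisation c →
    (v : Fin (n + n)) → KConfiguration c 2 v →
    (v' : Fin (n + n)) → AdjacentConfigurations v v' →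
    KConfiguration c 3 v'
mainTheorem15 (suc (suc (suc _))) (s≤s (s≤s (s≤s _))) _ _ isOF _ two-colours _ adjacent =
  adjacent-to-2-configuration⇒3-configuration isOF two-colours adjacent
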